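{- Let $G$ be a finite bipartite graph with bipartition $(X,Y)$. If $G$ contains an invertible pair, then $\overline{G}$ does not have a $T$-free orientation.
   Context: Two edges $xy, x'y'$ of $G$ ($x,x'\in X$, $y,y'\in Y$) are independent if $x\ne x'$, $y\neq y'$ and $xy'\notin E(G)$, $x'y\notin E(G)$. A walk $a_1a_2\dots a_k$ is an $(a_1,a_k)$-walk. Two walks $a_1\dots a_k$ and $b_1\dots b_k$ with $a_1,b_1$ in the same part are congruent if they have the same length and for each $i=1,\dots,k-1$ the edges $a_ia_{i+1}$ and $b_ib_{i+1}$ are independent. A pair of vertices $u,v$ is an invertible pair if there exist congruent walks $W,W'$ where $W$ is a $(u,v)$-walk and $W'$ is a $(v,u)$-walk. Let $\overline G$ be the complement of $G$. An orientation of $\overline{G}$ is a mixed graph in which every edge of $\overline{G}$ between $X$ and $Y$ (i.e., every non-edge $xy$ of $G$ with $x\in X,y\in Y$) stays undirected and every pair of distinct vertices both in $X$ or both in $Y$ is oriented in exactly one direction. It is $T$-free if there are no $x,x'\in X$, $y,y'\in Y$ with $xy, x'y'\notin E(G)$, $xy', x'y\in E(G)$, such that it contains both arcs $x\to x'$ and $y\to y'$. -}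

module Defs where

open import Data.Nat using (ℕ; suc)
open import Data.Fin using (Fin; zero; suc; fromℕ; inject₁)
open import Data.Bool using (Bool; true; false)
open import Data.Sum using (_⊎_; inj₁; inj₂)
open import Data.Product using (_×_; Σ; ∃; ∃-syntax; _,_)
open import Data.Empty using (⊥)
open import Data.Unit using (⊤)
open import Relation.Nullary using (¬_)
open import Relation.Binary.PropositionalEquality using (_≡_; _≢_)

-- A finite bipartite graph G with bipartition (X,Y), X = Fin m, Y = Fin n,
-- given by its (decidable) adjacency between X and Y.
BipGraph : ℕ → ℕ → Set
BipGraph m n = Fin m → Fin n → Bool

module _ {m n : ℕ} (G : BipGraph m n) where

  Edge : Fin m → Fin n → Set
  Edge x y = G x y ≡ true

  V : Set
  V = Fin m ⊎ Fin n

  SamePart : V → V → Set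
  SamePart (inj₁ _) (inj₁ _) = ⊤
  SamePart (inj₂ _) (inj₂ _) = ⊤
  SamePart _ _ = ⊥

  Adj : V → V → Set
  Adj (inj₁ x) (inj₂ y) = Edge x y
  Adj (inj₂ y) (inj₁ x) = Edge x y
  Adj _ _ = ⊥

  IndependentXY : Fin m → Fin n → Fin m → Fin n → Set
  IndependentXY x y x' y' =
    Edge x y × Edge x' y' × x ≢ x' × y ≢ y' × ¬ Edge x y' × ¬ Edge x' y

  Independent : V → V → V → V → Set
  Independent (inj₁ x) (inj₂ y) (inj₁ x') (inj₂ y') = IndependentXY x y x' y'
  Independent (inj₂ y) (inj₁ x) (inj₂ y') (inj₁ x') = IndependentXY x y x' y'
  Independent _ _ _ _ = ⊥

  -- a walk a_0 a_1 … a_k of length k (k+1 vertices)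
  record Walk (k : ℕ) : Set where
    field
      vtx  : Fin (suc k) → V
      step : (i : Fin k) → Adj (vtx (inject₁ i)) (vtx (suc i))

  open Walk public

  start end : ∀ {k} → Walk k → V
  start W = vtx W zero
  end {k} W = vtx W (fromℕ k)

  Congruent : ∀ {k} → Walk k → Walk k → Set
  Congruent {k} W W' =
    SamePart (start W) (start W') ×
    ((i : Fin k) → Independent (vtx W (inject₁ i)) (vtx W (suc i))
                               (vtx W' (inject₁ i)) (vtx W' (suc i)))

  InvertiblePair : V → V → Set
  InvertiblePair u v =
    u ≢ v × Σ ℕ λ k → Σ (Walk k) λ W → Σ (Walk k) λ W' →
      start W ≡ u × end W ≡ v × start W' ≡ v × end W' ≡ u × Congruent W W'

  HasInvertiblePair : Set
  HasInvertiblePair = Σ V λ u → Σ V λ v → InvertiblePair u v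

  -- an orientation of the complement: the X–Y non-edges stay undirected
  -- (no data needed); every pair of distinct vertices of X (resp. Y) is
  -- oriented in exactly one direction.
  record Orientation : Set₁ where
    field
      arcX   : Fin m → Fin m → Set
      arcY   : Fin n → Fin n → Set
      totX   : ∀ x x' → x ≢ x' → arcX x x' ⊎ arcX x' x
      totY   : ∀ y y' → y ≢ y' → arcY y y' ⊎ arcY y' y
      asymX  : ∀ x x' → arcX x x' → ¬ arcX x' x
      asymY  : ∀ y y' → arcY y y' → ¬ arcY y' y
      irrX   : ∀ x → ¬ arcX x x
      irrY   : ∀ y → ¬ arcY y y

  open Orientation public

  TFree : Orientation → Set
  TFree O = ¬ (Σ (Fin m) λ x → Σ (Fin m) λ x' → Σ (Fin n) λ y → Σ (Fin n) λ y' →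
    ¬ Edge x y × ¬ Edge x' y' × Edge x y' × Edge x' y ×
    arcX O x x' × arcY O y y')

  HasTFreeOrientation : Set₁
  HasTFreeOrientation = Σ Orientation TFree

module Submission where

-- Merge the two tournaments of an orientation O of the
-- complement into one relation Arc on V = X ⊎ Y.  If O is T-free, then for
-- independent edges ab and a'b' an arc a → a' forces the arc b → b': the
-- other direction b' → b would be exactly a forbidden T-configuration.
-- Following two congruent walks edge by edge, an arc between their first
-- vertices is therefore carried to an arc between their last vertices.
-- For an invertible pair {u,v} with congruent walks W : u ⇝ v and
-- W' : v ⇝ u this turns an arc u → v into an arc v → u.  Since invertible
-- pairs are symmetric (swap W and W'), the same holds with u and v
-- exchanged; but u ≠ v lie in the same part, so O orients them in exactly
-- one direction — a contradiction.

open import Defs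
open import Data.Nat using (ℕ; zero; suc)
open import Data.Fin using (Fin; zero; suc; fromℕ; inject₁)
open import Data.Sum using (_⊎_; inj₁; inj₂)
open import Data.Product using (Σ; _,_)
open import Data.Empty using (⊥; ⊥-elim)
open import Relation.Nullary using (¬_)
open import Relation.Binary.PropositionalEquality
  using (_≢_; sym; cong; subst₂)

propagate : {A : Set} (R : A → A → Set) (k : ℕ) (f f' : Fin (suc k) → A) →
  (∀ i → R (f (inject₁ i)) (f' (inject₁ i)) → R (f (suc i)) (f' (suc i))) →
  R (f zero) (f' zero) → R (f (fromℕ k)) (f' (fromℕ k))
propagate R zero    f f' step r = r
propagate R (suc k) f f' step r =
  step (fromℕ k)
    (propagate R k (λ i → f (inject₁ i)) (λ i → f' (inject₁ i))
                   (λ i → step (inject₁ i)) r)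

module _ {m n : ℕ} (G : BipGraph m n) where

  independent-sym : ∀ a b a' b' → Independent G a b a' b' → Independent G a' b' a b
  independent-sym (inj₁ x) (inj₂ y) (inj₁ x') (inj₂ y') (e , e' , x≢x' , y≢y' , ¬xy' , ¬x'y) =
    e' , e , (λ p → x≢x' (sym p)) , (λ p → y≢y' (sym p)) , ¬x'y , ¬xy'
  independent-sym (inj₂ y) (inj₁ x) (inj₂ y') (inj₁ x') (e , e' , x≢x' , y≢y' , ¬xy' , ¬x'y) =
    e' , e , (λ p → x≢x' (sym p)) , (λ p → y≢y' (sym p)) , ¬x'y , ¬xy'

  samePart-sym : ∀ a b → SamePart G a b → SamePart G b a
  samePart-sym (inj₁ _) (inj₁ _) t = t
  samePart-sym (inj₂ _) (inj₂ _) t = t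

  congruent-sym : ∀ {k} (W W' : Walk G k) → Congruent G W W' → Congruent G W' W
  congruent-sym W W' (same , ind) =
    samePart-sym _ _ same , λ i → independent-sym _ _ _ _ (ind i)

  invertiblePair-sym : ∀ u v → InvertiblePair G u v → InvertiblePair G v u
  invertiblePair-sym u v (u≢v , k , W , W' , su , ev , sv , eu , cong-WW') =
    (λ p → u≢v (sym p)) , k , W' , W , sv , eu , su , ev , congruent-sym W W' cong-WW'

  invertiblePair-samePart : ∀ u v → InvertiblePair G u v → SamePart G u v
  invertiblePair-samePart u v (_ , k , W , W' , su , _ , sv , _ , same , _) =
    subst₂ (SamePart G) su sv same

module _ {m n : ℕ} (G : BipGraph m n) (O : Orientation G) where

  Arc : V G → V G → Set
  Arc (inj₁ x) (inj₁ x') = arcX O x x'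
  Arc (inj₂ y) (inj₂ y') = arcY O y y'
  Arc _ _ = ⊥

  arc-asym : ∀ a b → Arc a b → ¬ Arc b a
  arc-asym (inj₁ x) (inj₁ x') = asymX O x x'
  arc-asym (inj₂ y) (inj₂ y') = asymY O y y'

  arc-total : ∀ a b → SamePart G a b → a ≢ b → Arc a b ⊎ Arc b a
  arc-total (inj₁ x) (inj₁ x') _ a≢b = totX O x x' (λ p → a≢b (cong inj₁ p))
  arc-total (inj₂ y) (inj₂ y') _ a≢b = totY O y y' (λ p → a≢b (cong inj₂ p))

  module _ (tfree : TFree G O) where

    -- For independent edges ab, a'b' of G, a T-free orientation with the
    -- arc a → a' must contain b → b': the arc b' → b would complete a T.
    independent-transports-arc : ∀ a b a' b' →
      Independent G a b a' b' → Arc a a' → Arc b b'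
    independent-transports-arc (inj₁ x) (inj₂ y) (inj₁ x') (inj₂ y')
                               (e , e' , _ , y≢y' , ¬xy' , ¬x'y) x→x'
      with totY O y y' y≢y'
    ... | inj₁ y→y' = y→y'
    ... | inj₂ y'→y = ⊥-elim (tfree (x , x' , y' , y , ¬xy' , ¬x'y , e , e' , x→x' , y'→y))
    independent-transports-arc (inj₂ y) (inj₁ x) (inj₂ y') (inj₁ x')
                               (e , e' , x≢x' , _ , ¬xy' , ¬x'y) y→y'
      with totX O x x' x≢x'
    ... | inj₁ x→x' = x→x'
    ... | inj₂ x'→x = ⊥-elim (tfree (x' , x , y , y' , ¬x'y , ¬xy' , e' , e , x'→x , y→y'))

    congruent-transports-arc : ∀ {k} (W W' : Walk G k) → Congruent G W W' →
      Arc (start G W) (start G W') → Arc (end G W) (end G W')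
    congruent-transports-arc {k} W W' (_ , ind) =
      propagate Arc k (vtx W) (vtx W')
        (λ i → independent-transports-arc _ _ _ _ (ind i))

    invertiblePair-reverses-arc : ∀ u v → InvertiblePair G u v → Arc u v → Arc v u
    invertiblePair-reverses-arc u v (_ , k , W , W' , su , ev , sv , eu , cong-WW') u→v =
      subst₂ Arc ev eu
        (congruent-transports-arc W W' cong-WW' (subst₂ Arc (sym su) (sym sv) u→v))

proposition2p2 : (m n : ℕ) (G : BipGraph m n) →
    HasInvertiblePair G → ¬ HasTFreeOrientation G
proposition2p2 m n G (u , v , inv@(u≢v , _)) (O , tfree)
  with arc-total G O u v (invertiblePair-samePart G u v inv) u≢v
... | inj₁ u→v =
  arc-asym G O u v u→v (invertiblePair-reverses-arc G O tfree u v inv u→v)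
... | inj₂ v→u =
  arc-asym G O v u v→u
    (invertiblePair-reverses-arc G O tfree v u (invertiblePair-sym G u v inv) v→u)
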